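{- Let $H_1=(T_1,U_1)$ and $H_2=(T_2,U_2)$ be modular graphs, $K=H_1\times H_2$ with path metric $d$, and let $H=(T,U)$ be an isometric modular subgraph of $K$ for which there exist $s_1\in T_1$, $s_2\in T_2$ with $(u,s_2)\in T$ and $(s_1,v)\in T$ for all $u\in T_1$, $v\in T_2$; put $s=(s_1,s_2)$. For $x\in V(K)$ let $\Delta^x=\min\{d(x,t):t\in T\}$, $N(x)=\{t\in T: d(x,t)=\Delta^x\}$, and $J(x)=\{v\in V(K): d(x,v)+d(v,s)=d(x,s)\}$. Then $N(x)\subseteq J(x)$ for every $x\in V(K)$.
   Context: Graphs are finite and connected. A graph $G$ is modular if every three nodes have a median (a node $v$ with $d^G(a,v)+d^G(v,b)=d^G(a,b)$ for each pair $a,b$ among them). A subgraph is isometric if distances in it agree with distances in the ambient graph. $H_1\times H_2$ is the Cartesian product: node set $T_1\times T_2$, with $(a,b)$ and $(a',b')$ adjacent iff ($a=a'$ and $bb'\in U_2$) or ($b=b'$ and $aa'\in U_1$). -}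

module Defs where

open import Data.Bool using (Bool; true; false; _∧_; _∨_; if_then_else_)
open import Data.Nat using (ℕ; zero; suc; _+_; _≤_)
open import Data.List using (List; length; cartesianProduct)
open import Data.Bool.ListAction using (any)
open import Data.List.Membership.Propositional using (_∈_)
open import Data.List.Membership.Propositional.Properties using (∈-cartesianProduct⁺)
open import Data.Product using (Σ; ∃; _×_; _,_; proj₁; proj₂)
open import Data.Product.Properties using (≡-dec)
open import Relation.Binary.PropositionalEquality using (_≡_)
open import Relation.Binary.Definitions using (DecidableEquality)
open import Relation.Nullary.Decidable using (⌊_⌋)

record Graph : Set₁ where
  field
    V        : Set
    _≟_      : DecidableEquality V
    vertices : List V
    complete : ∀ v → v ∈ vertices
    adj      : V → V → Bool

open Graph public

record Simple (G : Graph) : Set where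
  field
    adj-sym     : ∀ a b → adj G a b ≡ adj G b a
    adj-irrefl  : ∀ a → adj G a a ≡ false

data Walk (G : Graph) : V G → V G → ℕ → Set where
  here : ∀ {a} → Walk G a a zero
  step : ∀ {a b c k} → adj G a b ≡ true → Walk G b c k → Walk G a c (suc k)

Connected : Graph → Set
Connected G = ∀ a b → ∃ λ k → Walk G a b k

reach : (G : Graph) → ℕ → V G → V G → Bool
reach G zero    a b = ⌊ _≟_ G a b ⌋
reach G (suc k) a b = reach G k a b ∨ any (λ c → adj G a c ∧ reach G k c b) (vertices G)

distFrom : (G : Graph) → ℕ → ℕ → V G → V G → ℕ
distFrom G zero     start a b = start
distFrom G (suc f)  start a b =
  if reach G start a b then start else distFrom G f (suc start) a b

-- path metric: length of a shortest walk (connected graphs on n nodes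
-- always have a shortest walk of length < n, which this search finds)
dist : (G : Graph) → V G → V G → ℕ
dist G a b = distFrom G (length (vertices G)) 0 a b

IsMedian : (G : Graph) → V G → V G → V G → V G → Set
IsMedian G a b c v =
    (dist G a v + dist G v b ≡ dist G a b)
  × (dist G b v + dist G v c ≡ dist G b c)
  × (dist G a v + dist G v c ≡ dist G a c)

Modular : Graph → Set
Modular G = ∀ a b c → Σ (V G) λ v → IsMedian G a b c v

_□_ : Graph → Graph → Graph
G₁ □ G₂ = record
  { V        = V G₁ × V G₂
  ; _≟_      = ≡-dec (_≟_ G₁) (_≟_ G₂)
  ; vertices = cartesianProduct (vertices G₁) (vertices G₂)
  ; complete = λ { (a , b) → ∈-cartesianProduct⁺ (complete G₁ a) (complete G₂ b) }
  ; adj      = λ { (a , b) (a' , b') →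
                   (⌊ _≟_ G₁ a a' ⌋ ∧ adj G₂ b b') ∨ (⌊ _≟_ G₂ b b' ⌋ ∧ adj G₁ a a') }
  }

-- H is a subgraph of K via an injective node map f preserving adjacency
-- (edges of H are edges of K); T = image of f.
record IsSubgraph (H K : Graph) (f : V H → V K) : Set where
  field
    inj      : ∀ a b → f a ≡ f b → a ≡ b
    pres-adj : ∀ a b → adj H a b ≡ true → adj K (f a) (f b) ≡ true

IsIsometric : (H K : Graph) → (V H → V K) → Set
IsIsometric H K f = ∀ a b → dist K (f a) (f b) ≡ dist H a b

-- Distances in H₁ □ H₂ add up coordinatewise, so it suffices to show that the
-- first coordinate t₁ of a nearest point t = (t₁ , t₂) lies between x₁ and s₁;
-- the second coordinate is the same statement with the factors swapped.
-- Let m be the median of x₁, t₁, s₁ in H₁ and r a median in H of t and the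
-- points (m , s₂), (s₁ , t₂) of T.  Lying between t and (s₁ , t₂) forces r to
-- have second coordinate t₂; lying between t and (m , s₂) and between (m , s₂)
-- and (s₁ , t₂) forces its first coordinate to be m, because m lies between t₁
-- and s₁.  So (m , t₂) ∈ T, and nearness of t gives d(x₁,t₁) ≤ d(x₁,m); as m
-- lies between x₁ and t₁, this means m = t₁, i.e. t₁ lies between x₁ and s₁.
module Submission where

open import Defs
open import Data.Bool using (true; false; T; _∧_)
open import Data.Bool.Properties using (T-≡; T-∨; T-∧)
open import Data.Empty using (⊥-elim)
open import Data.Nat using (zero; suc; _+_; _≤_; _<_; z≤n; s≤s)
open import Data.Nat.Properties
  using ( ≤-refl; ≤-reflexive; ≤-trans; ≤-antisym; <⇒≤; m≤n⇒m≤1+n; m≤n⇒m<n∨m≡n; n≤0⇒n≡0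
        ; +-comm; +-suc; +-identityʳ; m≤m+n; m+n≡0⇒m≡0; +-mono-≤; +-monoˡ-≤; +-monoʳ-≤
        ; +-cancelˡ-≤; +-cancelʳ-≤; +-cancelˡ-≡; +-commutativeSemigroup; module ≤-Reasoning )
open import Algebra.Properties.CommutativeSemigroup +-commutativeSemigroup using (interchange)
open import Data.Nat.Induction using (<-wellFounded)
open import Induction.WellFounded using (Acc; acc)
open import Data.List using (List; []; _∷_; _++_; length)
open import Data.List.Properties using (length-++-sucʳ)
open import Data.List.Membership.Propositional using (_∈_; lose)
open import Data.List.Membership.Propositional.Properties using (∈-++⁺ˡ; ∈-++⁺ʳ; ∈-++⁻; ∈-∃++)
import Data.List.Membership.DecPropositional as DecMembership
open import Data.List.Relation.Unary.Any using (here; there; satisfied)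
open import Data.List.Relation.Unary.Any.Properties using (any⁺; any⁻)
import Data.List.Relation.Unary.All as All
open import Data.List.Relation.Unary.All.Properties using (¬Any⇒All¬)
open import Data.List.Relation.Unary.AllPairs using ([]; _∷_)
open import Data.List.Relation.Unary.Unique.Propositional using (Unique)
open import Data.Product using (Σ; ∃; ∃₂; _×_; _,_; proj₁; proj₂; swap; map₂)
open import Data.Sum using (_⊎_; inj₁; inj₂)
open import Function using (_∘_; Equivalence)
open Equivalence using (to; from)
open import Relation.Nullary.Decidable using (yes; no; toWitness; fromWitness)
open import Relation.Binary.PropositionalEquality
  using (_≡_; refl; sym; trans; cong; cong₂; subst; subst₂)

m+n≤n⇒m≡0 : ∀ m n → m + n ≤ n → m ≡ 0
m+n≤n⇒m≡0 m n le = n≤0⇒n≡0 (+-cancelʳ-≤ n m 0 le)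

m+n≤m⇒n≡0 : ∀ m n → m + n ≤ m → n ≡ 0
m+n≤m⇒n≡0 m n le = m+n≤n⇒m≡0 n m (subst (_≤ m) (+-comm m n) le)

+-tight : ∀ {x y u v} → x + y ≡ u + v → u ≤ x → v ≤ y → x ≡ u × y ≡ v
+-tight {x} {y} {u} {v} eq u≤x v≤y = x≡u , +-cancelˡ-≡ x y v (trans eq (cong (_+ v) (sym x≡u)))
  where
  x≡u : x ≡ u
  x≡u = ≤-antisym (+-cancelʳ-≤ y x u (≤-trans (≤-reflexive eq) (+-monoʳ-≤ u v≤y))) u≤x

Unique⊆⇒length≤ : ∀ {A : Set} {xs ys : List A} →
  Unique xs → (∀ {z} → z ∈ xs → z ∈ ys) → length xs ≤ length ys
Unique⊆⇒length≤ [] _ = z≤n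
Unique⊆⇒length≤ {xs = x ∷ xs} (x∉xs ∷ unique) xs⊆ys with ∈-∃++ (xs⊆ys (here refl))
... | ys₁ , ys₂ , refl =
  subst (suc (length xs) ≤_) (sym (length-++-sucʳ ys₁ x ys₂))
        (s≤s (Unique⊆⇒length≤ unique xs⊆ys₁++ys₂))
  where
  xs⊆ys₁++ys₂ : ∀ {z} → z ∈ xs → z ∈ ys₁ ++ ys₂
  xs⊆ys₁++ys₂ z∈xs with ∈-++⁻ ys₁ (xs⊆ys (there z∈xs))
  ... | inj₁ z∈ys₁         = ∈-++⁺ˡ z∈ys₁
  ... | inj₂ (here refl)   = ⊥-elim (All.lookup x∉xs z∈xs refl)
  ... | inj₂ (there z∈ys₂) = ∈-++⁺ʳ ys₁ z∈ys₂

module _ {G : Graph} where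

  _++ʷ_ : ∀ {a b c j k} → Walk G a b j → Walk G b c k → Walk G a c (j + k)
  here     ++ʷ w′ = w′
  step e w ++ʷ w′ = step e (w ++ʷ w′)

  walkVertices : ∀ {a b k} → Walk G a b k → List (V G)
  walkVertices {a} here       = a ∷ []
  walkVertices {a} (step e w) = a ∷ walkVertices w

  length-walkVertices : ∀ {a b k} (w : Walk G a b k) → length (walkVertices w) ≡ suc k
  length-walkVertices here       = refl
  length-walkVertices (step e w) = cong suc (length-walkVertices w)

  walk-from-visited : ∀ {a b c k} (w : Walk G a b k) →
    c ∈ walkVertices w → ∃ λ j → j ≤ k × Walk G c b j
  walk-from-visited here         (here refl)  = 0 , z≤n , here
  walk-from-visited w@(step e _) (here refl)  = _ , ≤-refl , w
  walk-from-visited (step e w)   (there c∈w) =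
    let j , j≤k , w′ = walk-from-visited w c∈w in j , m≤n⇒m≤1+n j≤k , w′

  shortcut-or-unique : ∀ {a b k} (w : Walk G a b k) →
    (∃ λ j → j < k × Walk G a b j) ⊎ Unique (walkVertices w)
  shortcut-or-unique here = inj₂ (All.[] ∷ [])
  shortcut-or-unique {a} (step e w) with shortcut-or-unique w
  ... | inj₁ (j , j<k , w′) = inj₁ (suc j , s≤s j<k , step e w′)
  ... | inj₂ unique with DecMembership._∈?_ (_≟_ G) a (walkVertices w)
  ...   | yes a∈w = let j , j≤k , w′ = walk-from-visited w a∈w in inj₁ (j , s≤s j≤k , w′)
  ...   | no  a∉w = inj₂ (¬Any⇒All¬ _ a∉w ∷ unique)

  walk-within-order : ∀ {a b k} → Walk G a b k → ∃ λ j → j ≤ length (vertices G) × Walk G a b j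
  walk-within-order w = shorten (<-wellFounded _) w
    where
    shorten : ∀ {a b k} → Acc _<_ k → Walk G a b k → ∃ λ j → j ≤ length (vertices G) × Walk G a b j
    shorten (acc shorter) w with shortcut-or-unique w
    ... | inj₁ (j , j<k , w′) = shorten (shorter j<k) w′
    ... | inj₂ unique = _ , <⇒≤ (subst (_≤ length (vertices G)) (length-walkVertices w)
                                  (Unique⊆⇒length≤ unique (λ {z} _ → complete G z))) , w

module _ (G : Graph) where

  reach-complete : ∀ {a b j} k → Walk G a b j → j ≤ k → T (reach G k a b)
  reach-complete {a} zero here z≤n = fromWitness {a? = _≟_ G a a} refl
  reach-complete (suc k) here _ = from T-∨ (inj₁ (reach-complete k here z≤n))
  reach-complete {a} {b} (suc k) (step {b = c} e w) (s≤s j≤k) =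
    from T-∨ (inj₂ (any⁺ (λ c → adj G a c ∧ reach G k c b) (lose (complete G c)
      (from T-∧ (from T-≡ e , reach-complete k w j≤k)))))

  reach-sound : ∀ {a b} k → T (reach G k a b) → ∃ λ j → j ≤ k × Walk G a b j
  reach-sound {a} {b} zero r with toWitness {a? = _≟_ G a b} r
  ... | refl = 0 , z≤n , here
  reach-sound (suc k) r with to T-∨ r
  ... | inj₁ r′ = let j , j≤k , w = reach-sound k r′ in j , m≤n⇒m≤1+n j≤k , w
  ... | inj₂ r′ with satisfied (any⁻ _ (vertices G) r′)
  ...   | c , adj∧reach with to T-∧ adj∧reach
  ...     | e , r″ = let j , j≤k , w = reach-sound k r″ in suc j , s≤s j≤k , step (to T-≡ e) w

  distFrom≤walk : ∀ {a b k} fuel start → start ≤ k → Walk G a b k → distFrom G fuel start a b ≤ k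
  distFrom≤walk zero start start≤k w = start≤k
  distFrom≤walk {a} {b} (suc fuel) start start≤k w with reach G start a b in eq
  ... | true = start≤k
  ... | false with m≤n⇒m<n∨m≡n start≤k
  ...   | inj₁ start<k = distFrom≤walk fuel (suc start) start<k w
  ...   | inj₂ refl    = ⊥-elim (subst T eq (reach-complete start w ≤-refl))

  distFrom-walk : ∀ {a b j} fuel start → j ≤ start + fuel → Walk G a b j →
    ∃ λ i → i ≤ distFrom G fuel start a b × Walk G a b i
  distFrom-walk {j = j} zero start j≤ w = j , subst (j ≤_) (+-identityʳ start) j≤ , w
  distFrom-walk {a} {b} {j} (suc fuel) start j≤ w with reach G start a b in eq
  ... | true  = reach-sound start (from T-≡ eq)
  ... | false = distFrom-walk fuel (suc start) (subst (j ≤_) (+-suc start fuel) j≤) w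

  dist≤walk : ∀ {a b k} → Walk G a b k → dist G a b ≤ k
  dist≤walk = distFrom≤walk (length (vertices G)) 0 z≤n

  dist-refl : ∀ a → dist G a a ≡ 0
  dist-refl a = n≤0⇒n≡0 (dist≤walk here)

  module _ (conn : Connected G) where

    geodesic : ∀ a b → ∃ λ j → j ≤ dist G a b × Walk G a b j
    geodesic a b =
      let j , j≤n , w = walk-within-order (proj₂ (conn a b))
      in distFrom-walk (length (vertices G)) 0 j≤n w

    dist≡0⇒≡ : ∀ {a b} → dist G a b ≡ 0 → a ≡ b
    dist≡0⇒≡ {a} {b} d≡0 with geodesic a b
    ... | j , j≤d , w with n≤0⇒n≡0 (subst (j ≤_) d≡0 j≤d)
    ...   | refl with w
    ...     | here = refl

    dist-triangle : ∀ a b c → dist G a c ≤ dist G a b + dist G b c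
    dist-triangle a b c =
      let j , j≤ , w = geodesic a b ; k , k≤ , w′ = geodesic b c
      in ≤-trans (dist≤walk (w ++ʷ w′)) (+-mono-≤ j≤ k≤)

Between : (G : Graph) → V G → V G → V G → Set
Between G a v b = dist G a v + dist G v b ≡ dist G a b

module _ (G : Graph) (conn : Connected G) where

  between-self⇒≡ : ∀ {a v} → Between G a v a → a ≡ v
  between-self⇒≡ {a} {v} a-v-a =
    dist≡0⇒≡ G conn (m+n≡0⇒m≡0 (dist G a v) (trans a-v-a (dist-refl G a)))

  between-nearest⇒≡ : ∀ {x m t} → Between G x m t → dist G x t ≤ dist G x m → m ≡ t
  between-nearest⇒≡ {x} {m} x-m-t t-nearer =
    dist≡0⇒≡ G conn (m+n≤m⇒n≡0 (dist G x m) _ (subst (_≤ dist G x m) (sym x-m-t) t-nearer))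

  between-both-sides⇒≡ : ∀ {t a m s} → Between G t a m → Between G m a s → Between G t m s → a ≡ m
  between-both-sides⇒≡ {t} {a} {m} {s} t-a-m m-a-s t-m-s =
    sym (dist≡0⇒≡ G conn
      (m+n≤n⇒m≡0 (dist G m a) (dist G a s) (+-cancelˡ-≤ (dist G t a) _ _ detour≤)))
    where
    detour≤ : dist G t a + (dist G m a + dist G a s) ≤ dist G t a + dist G a s
    detour≤ = begin
      dist G t a + (dist G m a + dist G a s)
        ≤⟨ +-monoˡ-≤ (dist G m a + dist G a s) (m≤m+n (dist G t a) (dist G a m)) ⟩
      (dist G t a + dist G a m) + (dist G m a + dist G a s)
        ≡⟨ cong₂ _+_ t-a-m m-a-s ⟩
      dist G t m + dist G m s
        ≡⟨ t-m-s ⟩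
      dist G t s
        ≤⟨ dist-triangle G conn t a s ⟩
      dist G t a + dist G a s
        ∎
      where open ≤-Reasoning

module _ (G₁ G₂ : Graph) where

  adj-□ˡ : ∀ {a a′} b → adj G₁ a a′ ≡ true → adj (G₁ □ G₂) (a , b) (a′ , b) ≡ true
  adj-□ˡ b e = to T-≡ (from T-∨ (inj₂ (from T-∧ (fromWitness {a? = _≟_ G₂ b b} refl , from T-≡ e))))

  adj-□ʳ : ∀ a {b b′} → adj G₂ b b′ ≡ true → adj (G₁ □ G₂) (a , b) (a , b′) ≡ true
  adj-□ʳ a e = to T-≡ (from T-∨ (inj₁ (from T-∧ (fromWitness {a? = _≟_ G₁ a a} refl , from T-≡ e))))

  adj-□⁻ : ∀ {a a′ b b′} → adj (G₁ □ G₂) (a , b) (a′ , b′) ≡ true →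
    (a ≡ a′ × adj G₂ b b′ ≡ true) ⊎ (b ≡ b′ × adj G₁ a a′ ≡ true)
  adj-□⁻ {a} {a′} {b} {b′} e with to T-∨ (from T-≡ e)
  ... | inj₁ r = let a≡a′ , e₂ = to T-∧ r in inj₁ (toWitness {a? = _≟_ G₁ a a′} a≡a′ , to T-≡ e₂)
  ... | inj₂ r = let b≡b′ , e₁ = to T-∧ r in inj₂ (toWitness {a? = _≟_ G₂ b b′} b≡b′ , to T-≡ e₁)

  walk-□ˡ : ∀ {a c j} b → Walk G₁ a c j → Walk (G₁ □ G₂) (a , b) (c , b) j
  walk-□ˡ b here       = here
  walk-□ˡ b (step e w) = step (adj-□ˡ b e) (walk-□ˡ b w)

  walk-□ʳ : ∀ a {b d j} → Walk G₂ b d j → Walk (G₁ □ G₂) (a , b) (a , d) j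
  walk-□ʳ a here       = here
  walk-□ʳ a (step e w) = step (adj-□ʳ a e) (walk-□ʳ a w)

  walk-□⁻ : ∀ {p q k} → Walk (G₁ □ G₂) p q k →
    ∃₂ λ k₁ k₂ → k₁ + k₂ ≡ k
               × Walk G₁ (proj₁ p) (proj₁ q) k₁ × Walk G₂ (proj₂ p) (proj₂ q) k₂
  walk-□⁻ here = 0 , 0 , refl , here , here
  walk-□⁻ (step e w) with walk-□⁻ w | adj-□⁻ e
  ... | k₁ , k₂ , refl , w₁ , w₂ | inj₁ (refl , e₂) = k₁ , suc k₂ , +-suc k₁ k₂ , w₁ , step e₂ w₂
  ... | k₁ , k₂ , refl , w₁ , w₂ | inj₂ (refl , e₁) = suc k₁ , k₂ , refl , step e₁ w₁ , w₂

  module _ (conn₁ : Connected G₁) (conn₂ : Connected G₂) where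

    connected-□ : Connected (G₁ □ G₂)
    connected-□ (a , b) (c , d) =
      let _ , _ , w₁ = geodesic G₁ conn₁ a c ; _ , _ , w₂ = geodesic G₂ conn₂ b d
      in _ , walk-□ˡ b w₁ ++ʷ walk-□ʳ c w₂

    dist-□ : ∀ p q →
      dist (G₁ □ G₂) p q ≡ dist G₁ (proj₁ p) (proj₁ q) + dist G₂ (proj₂ p) (proj₂ q)
    dist-□ (a , b) (c , d) = ≤-antisym ≤-sum sum-≤
      where
      ≤-sum : dist (G₁ □ G₂) (a , b) (c , d) ≤ dist G₁ a c + dist G₂ b d
      ≤-sum =
        let j₁ , j₁≤ , w₁ = geodesic G₁ conn₁ a c ; j₂ , j₂≤ , w₂ = geodesic G₂ conn₂ b d
        in ≤-trans (dist≤walk (G₁ □ G₂) (walk-□ˡ b w₁ ++ʷ walk-□ʳ c w₂)) (+-mono-≤ j₁≤ j₂≤)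
      sum-≤ : dist G₁ a c + dist G₂ b d ≤ dist (G₁ □ G₂) (a , b) (c , d)
      sum-≤ with geodesic (G₁ □ G₂) connected-□ (a , b) (c , d)
      ... | j , j≤ , w with walk-□⁻ w
      ...   | k₁ , k₂ , refl , w₁ , w₂ =
        ≤-trans (+-mono-≤ (dist≤walk G₁ w₁) (dist≤walk G₂ w₂)) j≤

    dist-□-path : ∀ p r q →
      dist (G₁ □ G₂) p r + dist (G₁ □ G₂) r q ≡
        (dist G₁ (proj₁ p) (proj₁ r) + dist G₁ (proj₁ r) (proj₁ q))
          + (dist G₂ (proj₂ p) (proj₂ r) + dist G₂ (proj₂ r) (proj₂ q))
    dist-□-path p r q = trans (cong₂ _+_ (dist-□ p r) (dist-□ r q))
      (interchange (dist G₁ (proj₁ p) (proj₁ r)) (dist G₂ (proj₂ p) (proj₂ r))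
                   (dist G₁ (proj₁ r) (proj₁ q)) (dist G₂ (proj₂ r) (proj₂ q)))

    between-□⁺ : ∀ {p r q} →
      Between G₁ (proj₁ p) (proj₁ r) (proj₁ q) → Between G₂ (proj₂ p) (proj₂ r) (proj₂ q) →
      Between (G₁ □ G₂) p r q
    between-□⁺ {p} {r} {q} between₁ between₂ =
      trans (dist-□-path p r q) (trans (cong₂ _+_ between₁ between₂) (sym (dist-□ p q)))

    between-□⁻ : ∀ {p r q} → Between (G₁ □ G₂) p r q →
      Between G₁ (proj₁ p) (proj₁ r) (proj₁ q) × Between G₂ (proj₂ p) (proj₂ r) (proj₂ q)
    between-□⁻ {p} {r} {q} between =
      +-tight (trans (sym (dist-□-path p r q)) (trans between (dist-□ p q)))
              (dist-triangle G₁ conn₁ _ _ _) (dist-triangle G₂ conn₂ _ _ _)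

dist-□-swap : ∀ G₁ G₂ → Connected G₁ → Connected G₂ →
  ∀ p q → dist (G₂ □ G₁) (swap p) (swap q) ≡ dist (G₁ □ G₂) p q
dist-□-swap G₁ G₂ conn₁ conn₂ p q =
  trans (dist-□ G₂ G₁ conn₂ conn₁ (swap p) (swap q))
    (trans (+-comm (dist G₂ (proj₂ p) (proj₂ q)) (dist G₁ (proj₁ p) (proj₁ q)))
           (sym (dist-□ G₁ G₂ conn₁ conn₂ p q)))

module _ (H K : Graph) (f : V H → V K) (iso : IsIsometric H K f) where

  isometric-between : ∀ {a v b} → Between H a v b → Between K (f a) (f v) (f b)
  isometric-between {a} {v} {b} a-v-b =
    trans (cong₂ _+_ (iso a v) (iso v b)) (trans a-v-b (sym (iso a b)))

  isometric-median : Modular H → ∀ a b c → Σ (V H) λ r → IsMedian K (f a) (f b) (f c) (f r)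
  isometric-median modular a b c =
    let r , a-r-b , b-r-c , a-r-c = modular a b c
    in r , isometric-between a-r-b , isometric-between b-r-c , isometric-between a-r-c

nearest-between₁ : (H₁ H₂ : Graph) → Connected H₁ → Modular H₁ → Connected H₂
  → (H : Graph) → Modular H
  → (f : V H → V (H₁ □ H₂)) → IsIsometric H (H₁ □ H₂) f
  → (s₁ : V H₁) (s₂ : V H₂)
  → (∀ u → Σ (V H) λ t → f t ≡ (u , s₂))
  → (∀ v → Σ (V H) λ t → f t ≡ (s₁ , v))
  → ∀ x t → (∀ t' → dist (H₁ □ H₂) x (f t) ≤ dist (H₁ □ H₂) x (f t'))
  → Between H₁ (proj₁ x) (proj₁ (f t)) s₁
nearest-between₁ H₁ H₂ conn₁ modular₁ conn₂ H modular f iso s₁ s₂ axis₁ axis₂ x t nearest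
  with modular₁ (proj₁ x) (proj₁ (f t)) s₁
... | m , x-m-t , t-m-s , x-m-s
  with axis₁ m | axis₂ (proj₂ (f t))
... | p , fp≡ms₂ | q , fq≡s₁t₂
  with isometric-median H (H₁ □ H₂) f iso modular t p q
... | r , t-r-p , p-r-q , t-r-q = subst (λ z → Between H₁ (proj₁ x) z s₁) m≡t₁ x-m-s
  where
  K : Graph
  K = H₁ □ H₂

  coordinates : ∀ {u w} → Between K u (f r) w →
    Between H₁ (proj₁ u) (proj₁ (f r)) (proj₁ w) × Between H₂ (proj₂ u) (proj₂ (f r)) (proj₂ w)
  coordinates = between-□⁻ H₁ H₂ conn₁ conn₂

  r₂≡t₂ : proj₂ (f r) ≡ proj₂ (f t)
  r₂≡t₂ = sym (between-self⇒≡ H₂ conn₂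
    (proj₂ (coordinates (subst (Between K (f t) (f r)) fq≡s₁t₂ t-r-q))))

  r₁≡m : proj₁ (f r) ≡ m
  r₁≡m = between-both-sides⇒≡ H₁ conn₁
    (proj₁ (coordinates (subst (Between K (f t) (f r)) fp≡ms₂ t-r-p)))
    (proj₁ (coordinates (subst₂ (λ u w → Between K u (f r) w) fp≡ms₂ fq≡s₁t₂ p-r-q)))
    t-m-s

  r-on-axis : f r ≡ (m , proj₂ (f t))
  r-on-axis = cong₂ _,_ r₁≡m r₂≡t₂

  t₁-nearer : dist H₁ (proj₁ x) (proj₁ (f t)) ≤ dist H₁ (proj₁ x) m
  t₁-nearer = +-cancelʳ-≤ (dist H₂ (proj₂ x) (proj₂ (f t))) _ _
    (subst₂ _≤_ (dist-□ H₁ H₂ conn₁ conn₂ x (f t))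
                (dist-□ H₁ H₂ conn₁ conn₂ x (m , proj₂ (f t)))
      (subst (λ z → dist K x (f t) ≤ dist K x z) r-on-axis (nearest r)))

  m≡t₁ : m ≡ proj₁ (f t)
  m≡t₁ = between-nearest⇒≡ H₁ conn₁ x-m-t t₁-nearer

mainTheorem10 : (H₁ H₂ : Graph)
    → Simple H₁ → Connected H₁ → Modular H₁
    → Simple H₂ → Connected H₂ → Modular H₂
    → (H : Graph) → Simple H → Connected H → Modular H
    → (f : V H → V (H₁ □ H₂))
    → IsSubgraph H (H₁ □ H₂) f
    → IsIsometric H (H₁ □ H₂) f
    → (s₁ : V H₁) (s₂ : V H₂)
    → (∀ u → Σ (V H) λ t → f t ≡ (u , s₂))
    → (∀ v → Σ (V H) λ t → f t ≡ (s₁ , v))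
    → ∀ (x : V (H₁ □ H₂)) (t : V H)
    → (∀ t' → dist (H₁ □ H₂) x (f t) ≤ dist (H₁ □ H₂) x (f t'))
    → dist (H₁ □ H₂) x (f t) + dist (H₁ □ H₂) (f t) (s₁ , s₂) ≡ dist (H₁ □ H₂) x (s₁ , s₂)
mainTheorem10 H₁ H₂ _ conn₁ modular₁ _ conn₂ modular₂ H _ _ modular f _ iso s₁ s₂ axis₁ axis₂ x t nearest =
  between-□⁺ H₁ H₂ conn₁ conn₂ first second
  where
  swap-dist : ∀ p q → dist (H₂ □ H₁) (swap p) (swap q) ≡ dist (H₁ □ H₂) p q
  swap-dist = dist-□-swap H₁ H₂ conn₁ conn₂

  first : Between H₁ (proj₁ x) (proj₁ (f t)) s₁
  first = nearest-between₁ H₁ H₂ conn₁ modular₁ conn₂ H modular f iso s₁ s₂ axis₁ axis₂ x t nearest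

  second : Between H₂ (proj₂ x) (proj₂ (f t)) s₂
  second = nearest-between₁ H₂ H₁ conn₂ modular₂ conn₁ H modular (swap ∘ f)
    (λ a b → trans (swap-dist (f a) (f b)) (iso a b)) s₂ s₁
    (map₂ (cong swap) ∘ axis₂) (map₂ (cong swap) ∘ axis₁)
    (swap x) t
    (λ t′ → subst₂ _≤_ (sym (swap-dist x (f t))) (sym (swap-dist x (f t′))) (nearest t′))
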